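{- Let $p$ be a fixed prime and $k$ a fixed natural number. Then: (i) the set $\{p^{nk}\mid n\in\mathbb{N}\}$ is definable by a variable-free arithmetic circuit; (ii) the set of Fermat numbers $\{2^{2^n}+1\mid n\in\mathbb{N}\}$ is definable by a variable-free arithmetic circuit.
   Context: $\mathbb{N}=\{0,1,2,\ldots\}$ and $2^{\mathbb{N}}$ denotes its power set. For $s,t\subseteq\mathbb{N}$ put $s\oplus t=\{m+n\mid m\in s,\ n\in t\}$ and $s\otimes t=\{m\cdot n\mid m\in s,\ n\in t\}$. A variable-free arithmetic circuit is a term built from the constants $\emptyset$, $\mathbb{N}$ and $\{n\}$ (for each $n\in\mathbb{N}$) using the binary operations $\cup,\cap,\oplus,\otimes$ and the unary operation of complement relative to $\mathbb{N}$. Such a term evaluates to a subset of $\mathbb{N}$, which is the set it defines. -}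

module Defs where

open import Data.Nat using (ℕ; _+_; _*_; _^_)
open import Data.Product using (Σ; ∃; ∃-syntax; _×_)
open import Data.Sum using (_⊎_)
open import Data.Empty using (⊥)
open import Data.Unit using (⊤)
open import Relation.Nullary using (¬_)
open import Relation.Binary.PropositionalEquality using (_≡_)
open import Function.Bundles using (_⇔_)

-- Variable-free arithmetic circuits (as terms).
data Circuit : Set where
  empty  : Circuit
  nat    : Circuit
  single : ℕ → Circuit
  _∪C_   : Circuit → Circuit → Circuit
  _∩C_   : Circuit → Circuit → Circuit
  _⊕C_   : Circuit → Circuit → Circuit
  _⊗C_   : Circuit → Circuit → Circuit
  compl  : Circuit → Circuit

SetN : Set₁
SetN = ℕ → Set

⟦_⟧ : Circuit → SetN
⟦ empty ⟧ m = ⊥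
⟦ nat ⟧ m = ⊤
⟦ single n ⟧ m = m ≡ n
⟦ C ∪C D ⟧ m = ⟦ C ⟧ m ⊎ ⟦ D ⟧ m
⟦ C ∩C D ⟧ m = ⟦ C ⟧ m × ⟦ D ⟧ m
⟦ C ⊕C D ⟧ m = ∃[ a ] ∃[ b ] (⟦ C ⟧ a × ⟦ D ⟧ b × m ≡ a + b)
⟦ C ⊗C D ⟧ m = ∃[ a ] ∃[ b ] (⟦ C ⟧ a × ⟦ D ⟧ b × m ≡ a * b)
⟦ compl C ⟧ m = ¬ ⟦ C ⟧ m

Definable : SetN → Set
Definable S = ∃[ C ] (∀ m → ⟦ C ⟧ m ⇔ S m)

PowerSet : ℕ → ℕ → SetN
PowerSet p k m = ∃[ n ] (m ≡ p ^ (n * k))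

Fermat : SetN
Fermat m = ∃[ n ] (m ≡ 2 ^ (2 ^ n) + 1)

module Submission where

-- * For a prime p, the powers of p are the positive numbers having no factor
--   a ≥ 2 that is prime to p; this is the circuit 'powerCircuit p'
--   (soundness: split m = p^e * u with p ∤ u; completeness: Euclid's lemma).
-- * (i) Among the powers of p, the numbers p^(nk) are exactly those congruent
--   to 1 modulo p^k − 1: writing e = r + qk with r < k, p^e ≡ p^r and
--   1 ≤ p^r ≤ p^k − 1, so p^e ≡ 1 forces r = 0.
-- * (ii) A = {1 + 2^j | j ≥ 1} is definable from the powers of 2. The Fermat
--   numbers are the elements of A without a factorisation (1 + 2^j) * c with
--   1 + 2^j ∈ A and c ≥ 2: if M = 2^n (2o+1) with o ≥ 1, then 1 + 2^(2^n) is
--   such a factor of 1 + 2^M; conversely, modulo 1 + 2^j we have 2^(2j) ≡ 1,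
--   which forces a factor 1 + 2^j of 1 + 2^(2^n) to have j = 2^n.

open import Defs
open import Data.Nat using (ℕ; zero; suc; _+_; _*_; _∸_; _^_; _≤_; _<_; z≤n; s≤s; NonZero; _%_; _/_)
open import Data.Nat.Properties
open import Data.Nat.DivMod using (m≡m%n+[m/n]*n; m%n<n)
open import Data.Nat.Divisibility
  using (_∣_; divides; _∣?_; ∣-refl; ∣1⇒≡1; 0∣⇒≡0; >⇒∤; ∣m+n∣m⇒∣n; ∣m∣n⇒∣m+n; ∣m⇒∣m*n; ∣n⇒∣m*n; m%n≡0⇒n∣m)
open import Data.Nat.Primality using (Prime; euclidsLemma; prime[2]; prime⇒nonZero; prime⇒nonTrivial)
open import Data.Nat.Base using (nonTrivial⇒n>1)
open import Data.Nat.Induction using (<-rec)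
open import Data.Nat.Tactic.RingSolver using (solve-∀)
open import Data.Product using (_×_; ∃-syntax; _,_)
open import Data.Sum using (inj₁; inj₂)
open import Data.Unit using (tt)
open import Relation.Nullary using (¬_; yes; no; contradiction)
open import Relation.Binary.PropositionalEquality
open import Relation.Binary using (tri<; tri≈; tri>)
open import Function.Bundles using (_⇔_; mk⇔; Equivalence)
open import Function.Properties.Equivalence using () renaming (refl to ⇔-refl; trans to ⇔-trans)

open Equivalence using (to; from)

_∖C_ : Circuit → Circuit → Circuit
C ∖C D = C ∩C compl D

atLeast : ℕ → Circuit
atLeast n = single n ⊕C nat

atLeast-correct : ∀ n m → ⟦ atLeast n ⟧ m ⇔ n ≤ m
atLeast-correct n m = mk⇔ elim intro
  where
    elim : ⟦ atLeast n ⟧ m → n ≤ m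
    elim (a , b , a≡n , _ , m≡a+b) = subst₂ _≤_ a≡n (sym m≡a+b) (m≤m+n a b)
    intro : n ≤ m → ⟦ atLeast n ⟧ m
    intro n≤m = n , m ∸ n , refl , tt , sym (m+[n∸m]≡n n≤m)

multiplesOf : ℕ → Circuit
multiplesOf d = single d ⊗C nat

multiplesOf-correct : ∀ d m → ⟦ multiplesOf d ⟧ m ⇔ d ∣ m
multiplesOf-correct d m = mk⇔ elim intro
  where
    elim : ⟦ multiplesOf d ⟧ m → d ∣ m
    elim (a , b , a≡d , _ , m≡a*b) = divides b (trans m≡a*b (trans (cong (_* b) a≡d) (*-comm d b)))
    intro : d ∣ m → ⟦ multiplesOf d ⟧ m
    intro (divides q m≡q*d) = d , q , refl , tt , trans m≡q*d (*-comm q d)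

multiple-below⇒zero : ∀ {d u} → d ∣ u → u < d → u ≡ 0
multiple-below⇒zero {u = zero}  _   _   = refl
multiple-below⇒zero {u = suc _} d∣u u<d = contradiction d∣u (>⇒∤ u<d)

odd⇒2∤ : ∀ q → ¬ 2 ∣ suc (2 * q)
odd⇒2∤ q (divides c eq) = even≢odd c q (sym (trans eq (*-comm c 2)))

2∤⇒odd : ∀ u → ¬ 2 ∣ u → ∃[ o ] (u ≡ suc (2 * o))
2∤⇒odd u 2∤u with u % 2 | m%n<n u 2 | m≡m%n+[m/n]*n u 2 | m%n≡0⇒n∣m u 2
... | zero        | _ | _       | rem0⇒2∣u = contradiction (rem0⇒2∣u refl) 2∤u
... | suc zero    | _ | u≡1+q*2 | _        = u / 2 , trans u≡1+q*2 (cong suc (*-comm (u / 2) 2))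
... | suc (suc _) | s≤s (s≤s ()) | _ | _

pow-divMod : ∀ b e t .{{_ : NonZero t}} → b ^ e ≡ b ^ (e % t) * (b ^ t) ^ (e / t)
pow-divMod b e t = begin
  b ^ e                           ≡⟨ cong (b ^_) (m≡m%n+[m/n]*n e t) ⟩
  b ^ (e % t + e / t * t)         ≡⟨ ^-distribˡ-+-* b (e % t) (e / t * t) ⟩
  b ^ (e % t) * b ^ (e / t * t)   ≡⟨ cong (λ x → b ^ (e % t) * b ^ x) (*-comm (e / t) t) ⟩
  b ^ (e % t) * b ^ (t * (e / t)) ≡⟨ cong (b ^ (e % t) *_) (sym (^-*-assoc b t (e / t))) ⟩
  b ^ (e % t) * (b ^ t) ^ (e / t) ∎
  where open ≡-Reasoning

IsPowerOf : ℕ → ℕ → Set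
IsPowerOf p m = ∃[ e ] (m ≡ p ^ e)

powerCircuit : ℕ → Circuit
powerCircuit p = compl (single 0 ∪C ((atLeast 2 ∖C multiplesOf p) ⊗C nat))

split-powerOf : ∀ p → 1 < p → ∀ m → 0 < m → ∃[ e ] ∃[ u ] (m ≡ p ^ e * u × ¬ p ∣ u)
split-powerOf p 1<p = <-rec Split step
  where
    Split : ℕ → Set
    Split m = 0 < m → ∃[ e ] ∃[ u ] (m ≡ p ^ e * u × ¬ p ∣ u)

    regroup : ∀ x u y → (x * u) * y ≡ (y * x) * u
    regroup = solve-∀

    step : ∀ m → (∀ {q} → q < m → Split q) → Split m
    step m rec 0<m with p ∣? m
    ... | no  p∤m = 0 , m , sym (*-identityˡ m) , p∤m
    ... | yes (divides q@(suc _) m≡q*p)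
        with rec (subst (q <_) (sym m≡q*p) (m<m*n q p 1<p)) (s≤s z≤n)
    ...   | e , u , q≡pᵉu , p∤u = suc e , u , trans m≡q*p (trans (cong (_* p) q≡pᵉu) (regroup (p ^ e) u p)) , p∤u
    step m rec 0<m | yes (divides zero m≡0) = contradiction m≡0 (m<n⇒n≢0 0<m)

module PrimePowers (p : ℕ) (p-prime : Prime p) where

  instance
    p≢0 : NonZero p
    p≢0 = prime⇒nonZero p-prime

  1<p : 1 < p
  1<p = nonTrivial⇒n>1 p {{prime⇒nonTrivial p-prime}}

  exponent-zero : ∀ {e} → p ^ e ≡ 1 → e ≡ 0
  exponent-zero {e} pᵉ≡1 with m^n≡1⇒n≡0∨m≡1 p e pᵉ≡1
  ... | inj₁ e≡0 = e≡0
  ... | inj₂ p≡1 = contradiction (sym p≡1) (<⇒≢ 1<p)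

  factor-of-power : ∀ e {a} → 2 ≤ a → a ∣ p ^ e → p ∣ a
  factor-of-power zero      2≤a a∣1 = contradiction (∣1⇒≡1 a∣1) λ a≡1 → <⇒≢ 2≤a (sym a≡1)
  factor-of-power (suc e) {a} 2≤a (divides b pᵉ⁺¹≡ba)
    with euclidsLemma b a p-prime (divides (p ^ e) (trans (sym pᵉ⁺¹≡ba) (*-comm p (p ^ e))))
  ... | inj₂ p∣a = p∣a
  ... | inj₁ (divides c b≡cp) = factor-of-power e 2≤a (divides c (*-cancelˡ-≡ (p ^ e) (c * a) p (begin
        p * p ^ e   ≡⟨ pᵉ⁺¹≡ba ⟩
        b * a       ≡⟨ cong (_* a) b≡cp ⟩
        c * p * a   ≡⟨ cong (_* a) (*-comm c p) ⟩
        p * c * a   ≡⟨ *-assoc p c a ⟩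
        p * (c * a) ∎)))
    where open ≡-Reasoning

  -- Soundness splits m = p^e * u with p ∤ u: u ≥ 2 would be a forbidden
  -- factor, so u = 1.  Completeness is factor-of-power.
  powerCircuit-correct : ∀ m → ⟦ powerCircuit p ⟧ m ⇔ IsPowerOf p m
  powerCircuit-correct m = mk⇔ elim intro
    where
      elim : ⟦ powerCircuit p ⟧ m → IsPowerOf p m
      elim noBadFactor with split-powerOf p 1<p m (n≢0⇒n>0 (λ m≡0 → noBadFactor (inj₁ m≡0)))
      ... | e , zero , m≡pᵉ0 , _ = contradiction (inj₁ (trans m≡pᵉ0 (*-zeroʳ (p ^ e)))) noBadFactor
      ... | e , suc zero , m≡pᵉ , _ = e , trans m≡pᵉ (*-identityʳ (p ^ e))
      ... | e , u@(suc (suc _)) , m≡pᵉu , p∤u = contradiction (inj₂ badFactor) noBadFactor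
        where
          badFactor : ⟦ (atLeast 2 ∖C multiplesOf p) ⊗C nat ⟧ m
          badFactor = u , p ^ e ,
            (from (atLeast-correct 2 u) (s≤s (s≤s z≤n)) , λ p∣u → p∤u (to (multiplesOf-correct p u) p∣u)) ,
            tt , trans m≡pᵉu (*-comm (p ^ e) u)
      intro : IsPowerOf p m → ⟦ powerCircuit p ⟧ m
      intro (e , m≡pᵉ) (inj₁ m≡0) = <⇒≢ (m^n>0 p e) (sym (trans (sym m≡pᵉ) m≡0))
      intro (e , m≡pᵉ) (inj₂ (a , b , (a≥2 , p∤a) , _ , m≡ab)) =
        p∤a (from (multiplesOf-correct p a)
          (factor-of-power e (to (atLeast-correct 2 a) a≥2) (divides b (trans (sym m≡pᵉ) (trans m≡ab (*-comm a b))))))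

OneMod : ℕ → ℕ → Set
OneMod d m = ∃[ b ] (m ≡ 1 + b × d ∣ b)

oneModCircuit : ℕ → Circuit
oneModCircuit d = single 1 ⊕C multiplesOf d

oneModCircuit-correct : ∀ d m → ⟦ oneModCircuit d ⟧ m ⇔ OneMod d m
oneModCircuit-correct d m = mk⇔ elim intro
  where
    elim : ⟦ oneModCircuit d ⟧ m → OneMod d m
    elim (a , b , a≡1 , d∣b , m≡a+b) = b , trans m≡a+b (cong (_+ b) a≡1) , to (multiplesOf-correct d b) d∣b
    intro : OneMod d m → ⟦ oneModCircuit d ⟧ m
    intro (b , m≡1+b , d∣b) = 1 , b , refl , from (multiplesOf-correct d b) d∣b , m≡1+b

oneMod-* : ∀ {d x y} → OneMod d x → OneMod d y → OneMod d (x * y)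
oneMod-* (b , x≡1+b , d∣b) (c , y≡1+c , d∣c) =
  b + c + b * c , trans (cong₂ _*_ x≡1+b y≡1+c) (expand b c) ,
  ∣m∣n⇒∣m+n (∣m∣n⇒∣m+n d∣b d∣c) (∣m⇒∣m*n c d∣b)
  where
    expand : ∀ b c → (1 + b) * (1 + c) ≡ 1 + (b + c + b * c)
    expand = solve-∀

oneMod-pow : ∀ d n → OneMod d (suc d ^ n)
oneMod-pow d zero    = 0 , refl , divides 0 refl
oneMod-pow d (suc n) = oneMod-* (d , refl , ∣-refl) (oneMod-pow d n)

oneMod-cancel : ∀ {d x y} → 0 < x → OneMod d (x * y) → OneMod d y → OneMod d x
oneMod-cancel {d} {x@(suc u)} {y} _ (b , xy≡1+b , d∣b) (c , y≡1+c , d∣c) =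
  u , refl , ∣m+n∣m⇒∣n (subst (d ∣_) b≡xc+u d∣b) (∣n⇒∣m*n x d∣c)
  where
    b≡xc+u : b ≡ x * c + u
    b≡xc+u = suc-injective (begin
      1 + b         ≡⟨ sym xy≡1+b ⟩
      x * y         ≡⟨ cong (x *_) y≡1+c ⟩
      x * (1 + c)   ≡⟨ expand u c ⟩
      1 + (x * c + u) ∎)
      where
        open ≡-Reasoning
        expand : ∀ u c → suc u * (1 + c) ≡ 1 + (suc u * c + u)
        expand = solve-∀

oneMod-small : ∀ {d x} → OneMod d x → x ≤ d → x ≡ 1
oneMod-small (b , x≡1+b , d∣b) x≤d =
  trans x≡1+b (cong suc (multiple-below⇒zero d∣b (subst (_≤ _) x≡1+b x≤d)))

-- Part (i): p^e ≡ 1 modulo p^k − 1 exactly when k divides e, so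
-- {p^(nk)} is cut out of the powers of p by a congruence.
module PowersOfPowers (p : ℕ) (p-prime : Prime p) where
  open PrimePowers p p-prime

  -- (p^k)^n = (1 + (p^k − 1))^n ≡ 1 modulo p^k − 1.
  oneMod-powerOfPower : ∀ k n → OneMod (p ^ k ∸ 1) ((p ^ k) ^ n)
  oneMod-powerOfPower k n =
    subst (λ x → OneMod (p ^ k ∸ 1) (x ^ n)) (m+[n∸m]≡n (m^n>0 p k)) (oneMod-pow (p ^ k ∸ 1) n)

  -- Conversely, p^e ≡ 1 forces k ∣ e: with r = e % k we get
  -- p^r ≡ p^e ≡ 1 and 1 ≤ p^r ≤ p^k − 1, hence p^r = 1 and r = 0.
  -- (For k = 0 the modulus is 0 and p^e = 1 directly.)
  oneMod-exponent : ∀ k e → OneMod (p ^ k ∸ 1) (p ^ e) → k ∣ e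
  oneMod-exponent zero e (b , pᵉ≡1+b , 0∣b) =
    divides 0 (exponent-zero (trans pᵉ≡1+b (cong suc (0∣⇒≡0 0∣b))))
  oneMod-exponent k@(suc _) e pᵉ≡1 = divides (e / k) (trans (m≡m%n+[m/n]*n e k) (cong (_+ e / k * k) r≡0))
    where
      pʳ≤pᵏ-1 : p ^ (e % k) ≤ p ^ k ∸ 1
      pʳ≤pᵏ-1 = ≤-pred (subst (p ^ (e % k) <_) (sym (m+[n∸m]≡n (m^n>0 p k))) (^-monoʳ-< p 1<p (m%n<n e k)))
      pʳ≡1 : p ^ (e % k) ≡ 1
      pʳ≡1 = oneMod-small
        (oneMod-cancel (m^n>0 p (e % k)) (subst (OneMod (p ^ k ∸ 1)) (pow-divMod p e k) pᵉ≡1) (oneMod-powerOfPower k (e / k)))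
        pʳ≤pᵏ-1
      r≡0 : e % k ≡ 0
      r≡0 = exponent-zero pʳ≡1

  powersOfPowers : ℕ → Circuit
  powersOfPowers k = powerCircuit p ∩C oneModCircuit (p ^ k ∸ 1)

  powersOfPowers-correct : ∀ k m → ⟦ powersOfPowers k ⟧ m ⇔ PowerSet p k m
  powersOfPowers-correct k m = mk⇔ elim intro
    where
      elim : ⟦ powersOfPowers k ⟧ m → PowerSet p k m
      elim (isPower , isOneMod) with to (powerCircuit-correct m) isPower
      ... | e , m≡pᵉ with oneMod-exponent k e (subst (OneMod (p ^ k ∸ 1)) m≡pᵉ (to (oneModCircuit-correct _ m) isOneMod))
      ...   | divides n e≡nk = n , trans m≡pᵉ (cong (p ^_) e≡nk)
      intro : PowerSet p k m → ⟦ powersOfPowers k ⟧ m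
      intro (n , m≡pⁿᵏ) =
        from (powerCircuit-correct m) (n * k , m≡pⁿᵏ) ,
        from (oneModCircuit-correct _ m) (subst (OneMod (p ^ k ∸ 1)) m≡pᵏⁿ (oneMod-powerOfPower k n))
        where
          m≡pᵏⁿ : (p ^ k) ^ n ≡ m
          m≡pᵏⁿ = trans (^-*-assoc p k n) (trans (cong (p ^_) (*-comm k n)) (sym m≡pⁿᵏ))

-- Part (ii).  Modulo 1 + a we have a * a ≡ 1, so even powers of a are invisible.

square-mod : ∀ a X → 1 + a ∣ 1 + (a * a) * X ⇔ 1 + a ∣ 1 + X
square-mod zero    X = mk⇔ (λ _ → divides (1 + X) (sym (*-identityʳ (1 + X)))) (λ _ → divides 1 refl)
square-mod (suc b) X = mk⇔
  (λ d∣lhs → ∣m+n∣m⇒∣n (subst (2 + b ∣_) (split b X) d∣lhs) multiple)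
  (λ d∣1+X → subst (2 + b ∣_) (sym (split b X)) (∣m∣n⇒∣m+n multiple d∣1+X))
  where
    split : ∀ b X → 1 + (suc b * suc b) * X ≡ (2 + b) * (b * X) + (1 + X)
    split = solve-∀
    multiple : 2 + b ∣ (2 + b) * (b * X)
    multiple = divides (b * X) (*-comm (2 + b) (b * X))

evenPower-mod : ∀ a q X → 1 + a ∣ 1 + (a * a) ^ q * X ⇔ 1 + a ∣ 1 + X
evenPower-mod a zero    X = subst (λ Y → 1 + a ∣ 1 + Y ⇔ 1 + a ∣ 1 + X) (sym (*-identityˡ X)) ⇔-refl
evenPower-mod a (suc q) X = ⇔-trans peel (evenPower-mod a q X)
  where
    peel : 1 + a ∣ 1 + (a * a) ^ suc q * X ⇔ 1 + a ∣ 1 + (a * a) ^ q * X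
    peel = subst (λ Y → 1 + a ∣ 1 + Y ⇔ 1 + a ∣ 1 + (a * a) ^ q * X)
                 (sym (*-assoc (a * a) ((a * a) ^ q) X)) (square-mod a ((a * a) ^ q * X))

-- For a ≥ 2 and o ≥ 1, 1 + a is a proper factor of 1 + a^(2o+1): it divides
-- 1 + (a^2)^o a by evenPower-mod, and the cofactor exceeds 1 since a^(2o+1) > a.
odd-power-factor : ∀ {a} → 2 ≤ a → ∀ o → 1 ≤ o → ∃[ c ] (1 + a ^ suc (2 * o) ≡ (1 + a) * c × 2 ≤ c)
odd-power-factor {a} 2≤a o 1≤o with from (evenPower-mod a o a) ∣-refl
... | divides c eq = c , c-eq , *-cancelˡ-< (1 + a) 1 c (begin-strict
    (1 + a) * 1       ≡⟨ *-identityʳ (1 + a) ⟩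
    1 + a             ≡⟨ cong suc (sym (*-identityʳ a)) ⟩
    1 + a ^ 1         <⟨ s≤s (^-monoʳ-< a 2≤a (s≤s (≤-trans 1≤o (m≤m+n o _)))) ⟩
    1 + a ^ suc (2 * o) ≡⟨ c-eq ⟩
    (1 + a) * c       ∎)
  where
    open ≤-Reasoning
    odd-pow : a ^ suc (2 * o) ≡ (a * a) ^ o * a
    odd-pow = begin-equality
      a * a ^ (2 * o)   ≡⟨ cong (a *_) (sym (^-*-assoc a 2 o)) ⟩
      a * (a * (a * 1)) ^ o ≡⟨ cong (λ x → a * (a * x) ^ o) (*-identityʳ a) ⟩
      a * (a * a) ^ o   ≡⟨ *-comm a _ ⟩
      (a * a) ^ o * a   ∎
    c-eq : 1 + a ^ suc (2 * o) ≡ (1 + a) * c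
    c-eq = trans (cong suc odd-pow) (trans eq (*-comm c (1 + a)))

module Two = PrimePowers 2 prime[2]

-- If 1 + a divides 1 + a d with 1 ≤ d ≤ a, then d = 1:
-- (1 + a)(1 + d') = (1 + a(1 + d')) + d' forces 1 + a ∣ d' < 1 + a.
factor-of-1+ad : ∀ {a d} → 1 + a ∣ 1 + a * d → 0 < d → d ≤ a → d ≡ 1
factor-of-1+ad {a} {suc d'} dvd _ d≤a =
  cong suc (multiple-below⇒zero (∣m+n∣m⇒∣n (divides (suc d') (split a d')) dvd) (≤-trans d≤a (n≤1+n a)))
  where
    split : ∀ a d' → 1 + a * suc d' + d' ≡ suc d' * (1 + a)
    split = solve-∀

-- For r < 2j, 1 + 2^j divides 1 + 2^r only when r = j: for r < j the divisor
-- is too large, and for r = j + s with 0 < s < j we have 2^r = 2^j 2^s, so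
-- factor-of-1+ad would give 2^s = 1.
pow2-residue : ∀ j r → r < j + j → 1 + 2 ^ j ∣ 1 + 2 ^ r → r ≡ j
pow2-residue j r r<2j dvd with <-cmp r j
... | tri< r<j _ _ = contradiction dvd (>⇒∤ (s≤s (^-monoʳ-< 2 (s≤s (s≤s z≤n)) r<j)))
... | tri≈ _ r≡j _ = r≡j
... | tri> _ _ j<r with m≤n⇒∃[o]m+o≡n j<r
...   | o , 1+j+o≡r = contradiction (Two.exponent-zero {suc o} 2ˢ≡1) λ ()
  where
    r≡j+s : r ≡ j + suc o
    r≡j+s = trans (sym 1+j+o≡r) (sym (+-suc j o))
    s≤j : suc o ≤ j
    s≤j = <⇒≤ (+-cancelˡ-< j (suc o) j (subst (_< j + j) r≡j+s r<2j))
    2ˢ≡1 : 2 ^ suc o ≡ 1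
    2ˢ≡1 = factor-of-1+ad (subst (λ x → 1 + 2 ^ j ∣ 1 + x) (trans (cong (2 ^_) r≡j+s) (^-distribˡ-+-* 2 j (suc o))) dvd)
      (m^n>0 2 (suc o)) (^-monoʳ-≤ 2 s≤j)

odd-divisor-of-pow2 : ∀ n q → suc (2 * q) ∣ 2 ^ n → q ≡ 0
odd-divisor-of-pow2 n zero    _   = refl
odd-divisor-of-pow2 n (suc q) dvd = contradiction (Two.factor-of-power n (s≤s (s≤s z≤n)) dvd) (odd⇒2∤ (suc q))

-- A number 1 + 2^j (j ≥ 1) divides the Fermat number 1 + 2^(2^n) only
-- with cofactor 1.  Write M = 2^n = r + q(2j) with r < 2j.  Modulo 1 + 2^j, 2^M ≡ 2^r, so
-- r = j by pow2-residue; then 2^n = j(2q + 1) forces q = 0, i.e. M = j.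
fermat-cofactor : ∀ n j c → 1 ≤ j → (1 + 2 ^ j) * c ≡ 1 + 2 ^ (2 ^ n) → c ≡ 1
fermat-cofactor n j@(suc _) c _ eq =
  *-cancelˡ-≡ c 1 (1 + a) (trans eq (trans (cong (λ x → 1 + 2 ^ x) M≡j) (sym (*-identityʳ (1 + a)))))
  where
    a M r q : ℕ
    a = 2 ^ j
    M = 2 ^ n
    r = M % (j + j)
    q = M / (j + j)
    2ᴹ≡ : 2 ^ M ≡ (a * a) ^ q * 2 ^ r
    2ᴹ≡ = trans (pow-divMod 2 M (j + j)) (trans (cong (λ x → 2 ^ r * x ^ q) (^-distribˡ-+-* 2 j j)) (*-comm (2 ^ r) _))
    r≡j : r ≡ j
    r≡j = pow2-residue j r (m%n<n M (j + j))
      (to (evenPower-mod a q (2 ^ r)) (divides c (trans (cong suc (sym 2ᴹ≡)) (trans (sym eq) (*-comm (1 + a) c)))))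
    M≡j[1+2q] : M ≡ j * suc (2 * q)
    M≡j[1+2q] = trans (m≡m%n+[m/n]*n M (j + j)) (trans (cong (_+ q * (j + j)) r≡j) (regroup j q))
      where
        regroup : ∀ j q → j + q * (j + j) ≡ j * suc (2 * q)
        regroup = solve-∀
    q≡0 : q ≡ 0
    q≡0 = odd-divisor-of-pow2 n q (divides j M≡j[1+2q])
    M≡j : M ≡ j
    M≡j = trans M≡j[1+2q] (trans (cong (λ x → j * suc (2 * x)) q≡0) (*-identityʳ j))

OnePlusPow2 : ℕ → Set
OnePlusPow2 m = ∃[ j ] (1 ≤ j × m ≡ 1 + 2 ^ j)

onePlusPow2 : Circuit
onePlusPow2 = single 1 ⊕C (powerCircuit 2 ∖C single 1)

onePlusPow2-correct : ∀ m → ⟦ onePlusPow2 ⟧ m ⇔ OnePlusPow2 m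
onePlusPow2-correct m = mk⇔ elim intro
  where
    elim : ⟦ onePlusPow2 ⟧ m → OnePlusPow2 m
    elim (a , b , a≡1 , (isPow , b≢1) , m≡a+b) with to (Two.powerCircuit-correct b) isPow
    ... | zero  , b≡1  = contradiction b≡1 b≢1
    ... | suc j , b≡2ʲ = suc j , s≤s z≤n , trans m≡a+b (cong₂ _+_ a≡1 b≡2ʲ)
    intro : OnePlusPow2 m → ⟦ onePlusPow2 ⟧ m
    intro (j , 1≤j , m≡1+2ʲ) =
      1 , 2 ^ j , refl , (from (Two.powerCircuit-correct (2 ^ j)) (j , refl) , 2ʲ≢1) , m≡1+2ʲ
      where
        2ʲ≢1 : ¬ 2 ^ j ≡ 1
        2ʲ≢1 2ʲ≡1 = <⇒≢ 1≤j (sym (Two.exponent-zero 2ʲ≡1))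

fermatCircuit : Circuit
fermatCircuit = onePlusPow2 ∖C (onePlusPow2 ⊗C atLeast 2)

fermatCircuit-correct : ∀ m → ⟦ fermatCircuit ⟧ m ⇔ Fermat m
fermatCircuit-correct m = mk⇔ elim intro
  where
    elim : ⟦ fermatCircuit ⟧ m → Fermat m
    elim (isA , noFactorisation) with to (onePlusPow2-correct m) isA
    ... | M , 1≤M , m≡1+2ᴹ with split-powerOf 2 (s≤s (s≤s z≤n)) M 1≤M
    ...   | n , u , M≡2ⁿu , 2∤u with 2∤⇒odd u 2∤u
    ...     | zero , u≡1 = n , trans m≡1+2ᴹ (trans (cong (λ x → 1 + 2 ^ x) M≡2ⁿ) (+-comm 1 _))
      where
        M≡2ⁿ : M ≡ 2 ^ n
        M≡2ⁿ = trans M≡2ⁿu (trans (cong (2 ^ n *_) u≡1) (*-identityʳ (2 ^ n)))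
    ...     | o@(suc _) , u≡1+2o with odd-power-factor (^-monoʳ-≤ 2 (m^n>0 2 n)) o (s≤s z≤n)
    ...       | c , a-eq , 2≤c = contradiction
        (1 + 2 ^ (2 ^ n) , c , from (onePlusPow2-correct _) (2 ^ n , m^n>0 2 n , refl) ,
         from (atLeast-correct 2 c) 2≤c , trans m≡1+2ᴹ (trans (cong suc 2ᴹ≡aᵘ) a-eq))
        noFactorisation
      where
        2ᴹ≡aᵘ : 2 ^ M ≡ (2 ^ (2 ^ n)) ^ suc (2 * o)
        2ᴹ≡aᵘ = trans (cong (2 ^_) (trans M≡2ⁿu (cong (2 ^ n *_) u≡1+2o))) (sym (^-*-assoc 2 (2 ^ n) _))
    intro : Fermat m → ⟦ fermatCircuit ⟧ m
    intro (n , m≡Fₙ) = from (onePlusPow2-correct m) (2 ^ n , m^n>0 2 n , m≡1+2ᴹ) , noFactorisation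
      where
        m≡1+2ᴹ : m ≡ 1 + 2 ^ (2 ^ n)
        m≡1+2ᴹ = trans m≡Fₙ (+-comm _ 1)
        noFactorisation : ¬ ⟦ onePlusPow2 ⊗C atLeast 2 ⟧ m
        noFactorisation (v , c , isA , c≥2 , m≡vc) with to (onePlusPow2-correct v) isA
        ... | j , 1≤j , v≡1+2ʲ =
          <⇒≢ (to (atLeast-correct 2 c) c≥2)
            (sym (fermat-cofactor n j c 1≤j (trans (sym (cong (_* c) v≡1+2ʲ)) (trans (sym m≡vc) m≡1+2ᴹ))))

theorem1 : ((p k : ℕ) → Prime p → Definable (PowerSet p k)) × Definable Fermat
theorem1 = part-i , (fermatCircuit , fermatCircuit-correct)
  where
    open PowersOfPowers using (powersOfPowers; powersOfPowers-correct)
    part-i : (p k : ℕ) → Prime p → Definable (PowerSet p k)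
    part-i p k p-prime = powersOfPowers p p-prime k , powersOfPowers-correct p p-prime k
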